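{- If $f\colon\omega\to\omega$ is total, then there is a set $B\subseteq\omega$ with $B\equiv_{\mathrm e}\mathrm{graph}(f)$ such that $\mathcal C_B\equiv_{\mathrm s}\mathcal E_{\mathrm{graph}(f)}$.
   Context: $\mathrm{graph}(f)=\{\langle n,f(n)\rangle:n\in\omega\}$ using the Cantor pairing function. $\leq_{\mathrm e}$ is enumeration reducibility and $\equiv_{\mathrm e}$ the induced equivalence. For $A\subseteq\omega$, $\mathcal C_A=\{g\in\omega^\omega: g\text{ one-to-one and }\mathrm{ran}(g)\subseteq A\}$ and $\mathcal E_A=\{g\in\omega^\omega:\mathrm{ran}(g)=A\}$. $\mathcal A\leq_{\mathrm s}\mathcal B$ (Medvedev reducibility) iff there is a Turing functional $\Phi$ with $\Phi(g)$ total and in $\mathcal A$ for all $g\in\mathcal B$; $\equiv_{\mathrm s}$ is reducibility in both directions. -}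

module Defs where

open import Data.Nat using (ℕ; zero; suc; _+_; _<_)
open import Data.Nat.Base using (⌊_/2⌋)
open import Data.Bool using (Bool; true; false)
open import Data.Fin using (Fin)
open import Data.Vec using (Vec; []; _∷_; lookup)
open import Data.Product using (Σ; ∃; _×_; _,_)
open import Relation.Binary.PropositionalEquality using (_≡_)
open import Function.Definitions using (Injective)
open import Level using (0ℓ)

-- Cantor pairing  ⟨x , y⟩ = (x+y)(x+y+1)/2 + y

tri : ℕ → ℕ
tri zero    = zero
tri (suc n) = suc n + tri n

⟪_,_⟫ : ℕ → ℕ → ℕ
⟪ x , y ⟫ = tri (x + y) + y

SetN : Set₁
SetN = ℕ → Set

graph : (ℕ → ℕ) → SetN
graph f k = Σ ℕ λ n → k ≡ ⟪ n , f n ⟫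

-- Canonical finite sets: D_u = { i : the i-th binary digit of u is 1 }

odd : ℕ → Bool
odd zero          = false
odd (suc zero)    = true
odd (suc (suc n)) = odd n

testBit : ℕ → ℕ → Bool
testBit u zero    = odd u
testBit u (suc i) = testBit ⌊ u /2⌋ i

_∈D_ : ℕ → ℕ → Set
i ∈D u = testBit u i ≡ true

data Code : ℕ → Set where
  zer  : ∀ {n} → Code n
  succ : Code 1
  proj : ∀ {n} → Fin n → Code n
  comp : ∀ {n m} → Code m → Vec (Code n) m → Code n
  prec : ∀ {n} → Code n → Code (suc (suc n)) → Code (suc n)
  mu   : ∀ {n} → Code (suc n) → Code n
  orc  : Code 1

module _ (g : ℕ → ℕ) where
  mutual
    data Eval : ∀ {n} → Code n → Vec ℕ n → ℕ → Set where
      ev-zer  : ∀ {n} {xs : Vec ℕ n} → Eval zer xs 0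
      ev-succ : ∀ {x} → Eval succ (x ∷ []) (suc x)
      ev-proj : ∀ {n} {i : Fin n} {xs} → Eval (proj i) xs (lookup xs i)
      ev-comp : ∀ {n m} {f : Code m} {hs : Vec (Code n) m} {xs ys y} →
                EvalAll xs hs ys → Eval f ys y → Eval (comp f hs) xs y
      ev-prec0 : ∀ {n} {f : Code n} {h : Code (suc (suc n))} {xs y} →
                 Eval f xs y → Eval (prec f h) (0 ∷ xs) y
      ev-precS : ∀ {n} {f : Code n} {h : Code (suc (suc n))} {xs k r y} →
                 Eval (prec f h) (k ∷ xs) r → Eval h (k ∷ r ∷ xs) y →
                 Eval (prec f h) (suc k ∷ xs) y
      ev-mu   : ∀ {n} {f : Code (suc n)} {xs y} →
                Search f xs 0 y → Eval (mu f) xs y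
      ev-orc  : ∀ {x} → Eval orc (x ∷ []) (g x)

    data EvalAll {n : ℕ} (xs : Vec ℕ n) : ∀ {m} → Vec (Code n) m → Vec ℕ m → Set where
      []  : EvalAll xs [] []
      _∷_ : ∀ {m} {h : Code n} {hs : Vec (Code n) m} {y ys} →
            Eval h xs y → EvalAll xs hs ys → EvalAll xs (h ∷ hs) (y ∷ ys)

    data Search {n : ℕ} (f : Code (suc n)) (xs : Vec ℕ n) : ℕ → ℕ → Set where
      stop : ∀ {k} → Eval f (k ∷ xs) 0 → Search f xs k k
      step : ∀ {k v y} → Eval f (k ∷ xs) (suc v) → Search f xs (suc k) y →
             Search f xs k y

-- The oracle is the constant-0 function,
-- which is itself computable, so this is exactly the class of c.e. relations.

CE2 : (ℕ → ℕ → Set) → Set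
CE2 W = Σ (Code 2) λ e → ∀ x u →
        (W x u → Σ ℕ λ y → Eval (λ _ → 0) e (x ∷ u ∷ []) y) ×
        ((Σ ℕ λ y → Eval (λ _ → 0) e (x ∷ u ∷ []) y) → W x u)

_≤e_ : SetN → SetN → Set₁
A ≤e B = Σ (ℕ → ℕ → Set) λ W → CE2 W × (∀ x →
           (A x → Σ ℕ λ u → W x u × (∀ i → i ∈D u → B i)) ×
           ((Σ ℕ λ u → W x u × (∀ i → i ∈D u → B i)) → A x))

_≡e_ : SetN → SetN → Set₁
A ≡e B = (A ≤e B) × (B ≤e A)

Mass : Set₁
Mass = (ℕ → ℕ) → Set

_≤s_ : Mass → Mass → Set
𝒜 ≤s ℬ = Σ (Code 1) λ Φ → ∀ g → ℬ g →
           Σ (ℕ → ℕ) λ h → (∀ n → Eval g Φ (n ∷ []) (h n)) × 𝒜 h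

_≡s_ : Mass → Mass → Set
𝒜 ≡s ℬ = (𝒜 ≤s ℬ) × (ℬ ≤s 𝒜)

𝒞 : SetN → Mass
𝒞 A g = Injective _≡_ _≡_ g × (∀ n → A (g n))

ℰ : SetN → Mass
ℰ A g = (∀ n → A (g n)) × (∀ a → A a → Σ ℕ λ n → g n ≡ a)

module Submission where

-- Take B to be the set of canonical indices of the finite initial segments f ↾ n of graph f.
-- A positive oracle for graph f confirms f ↾ n ⊆ graph f, and every pair ⟪ n , f n ⟫ lies in
-- some f ↾ (n + 1), so B ≡e graph f. Since the members of B are single valued, any finite part of
-- graph f determines f on its domain: an injective sequence in B names arbitrarily long segments,
-- so it computes f and hence an enumeration of graph f; conversely an enumeration of graph f
-- computes f, hence the strictly increasing (so injective) sequence n ↦ f ↾ n of members of B.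

open import Defs
open import Data.Bool using (Bool; true; false; not)
open import Data.Empty using (⊥-elim)
open import Data.Fin using (Fin; toℕ; fromℕ<) renaming (zero to fzero; suc to fsuc)
import Data.Fin.Properties as Fin
open import Data.Nat
  using (ℕ; zero; suc; _+_; _*_; _∸_; _^_; _≤_; _<_; _≟_; _<?_; z≤n; s≤s; s≤s⁻¹; pred; ⌊_/2⌋; ∣_-_∣)
open import Data.Nat.Properties
open import Data.Product using (Σ; ∃; _×_; _,_; proj₁; proj₂)
open import Data.Sum using (inj₁; inj₂)
open import Data.Vec using (Vec; []; _∷_)
open import Function using (id)
open import Function.Definitions using (Injective)
open import Relation.Binary using (tri<; tri≈; tri>)
open import Relation.Binary.PropositionalEquality
open import Relation.Nullary using (yes; no)

module _ {g : ℕ → ℕ} where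
  mutual
    eval-deterministic : ∀ {n} {c : Code n} {xs y y′} → Eval g c xs y → Eval g c xs y′ → y ≡ y′
    eval-deterministic ev-zer ev-zer = refl
    eval-deterministic ev-succ ev-succ = refl
    eval-deterministic ev-proj ev-proj = refl
    eval-deterministic (ev-comp as e) (ev-comp as′ e′) with evalAll-deterministic as as′
    ... | refl = eval-deterministic e e′
    eval-deterministic (ev-prec0 e) (ev-prec0 e′) = eval-deterministic e e′
    eval-deterministic (ev-precS e h) (ev-precS e′ h′) with eval-deterministic e e′
    ... | refl = eval-deterministic h h′
    eval-deterministic (ev-mu s) (ev-mu s′) = search-deterministic s s′
    eval-deterministic ev-orc ev-orc = refl

    evalAll-deterministic : ∀ {n m} {xs : Vec ℕ n} {cs : Vec (Code n) m} {ys ys′} →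
                            EvalAll g xs cs ys → EvalAll g xs cs ys′ → ys ≡ ys′
    evalAll-deterministic [] [] = refl
    evalAll-deterministic (e ∷ es) (e′ ∷ es′) =
      cong₂ _∷_ (eval-deterministic e e′) (evalAll-deterministic es es′)

    search-deterministic : ∀ {n} {c : Code (suc n)} {xs k y y′} →
                           Search g c xs k y → Search g c xs k y′ → y ≡ y′
    search-deterministic (stop e) (stop e′) = refl
    search-deterministic (stop e) (step e′ s′) with eval-deterministic e e′
    ... | ()
    search-deterministic (step e s) (stop e′) with eval-deterministic e e′
    ... | ()
    search-deterministic (step e s) (step e′ s′) = search-deterministic s s′

  search-end : ∀ {n} {c : Code (suc n)} {xs k y} → Search g c xs k y → Eval g c (y ∷ xs) 0
  search-end (stop e) = e
  search-end (step e s) = search-end s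

-- The least zero of t below x; x itself when there is none.
firstZero : (ℕ → ℕ) → ℕ → ℕ
firstZero t zero = zero
firstZero t (suc x) with t (firstZero t x)
... | zero = firstZero t x
... | suc _ = suc x

firstZero-zero : ∀ (t : ℕ → ℕ) {x y} → y ≤ x → t y ≡ 0 → t (firstZero t x) ≡ 0
firstZero-zero t {zero} z≤n ty = ty
firstZero-zero t {suc x} {y} y≤1+x ty with t (firstZero t x) in eq
... | zero = eq
... | suc _ with m≤n⇒m<n∨m≡n y≤1+x
...   | inj₂ refl = ty
...   | inj₁ (s≤s y≤x) with trans (sym eq) (firstZero-zero t y≤x ty)
...     | ()

firstZero-minimal : ∀ (t : ℕ → ℕ) x {k} → k < firstZero t x → t k ≢ 0
firstZero-minimal t (suc x) {k} k< tk with t (firstZero t x) in eq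
... | zero = firstZero-minimal t x k< tk
firstZero-minimal t (suc x) (s≤s k≤x) tk | suc _ with trans (sym eq) (firstZero-zero t k≤x tk)
... | ()

firstZero-unique : ∀ (t : ℕ → ℕ) {x y} → y ≤ x → t y ≡ 0 → (∀ k → k < y → t k ≢ 0) →
                   firstZero t x ≡ y
firstZero-unique t {x} {y} y≤x ty below with <-cmp (firstZero t x) y
... | tri< lt _ _ = ⊥-elim (below _ lt (firstZero-zero t y≤x ty))
... | tri≈ _ eq _ = eq
... | tri> _ _ gt = ⊥-elim (firstZero-minimal t x gt ty)

module _ {g : ℕ → ℕ} {n} {c : Code (suc n)} {xs : Vec ℕ n}
         (t : ℕ → ℕ) (c-eval : ∀ k → Eval g c (k ∷ xs) (t k)) where

  search-from : ∀ {y} → t y ≡ 0 → (∀ k → k < y → t k ≢ 0) → ∀ d {k} → d + k ≡ y → Search g c xs k y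
  search-from ty below zero refl = stop (subst (Eval g c _) ty (c-eval _))
  search-from ty below (suc d) {k} refl with t k in tk
  ... | zero = ⊥-elim (below k (s≤s (m≤n+m k d)) tk)
  ... | suc _ = step (subst (Eval g c _) tk (c-eval k)) (search-from ty below d (+-suc d k))

  eval-mu : ∀ {x} → t x ≡ 0 → Eval g (mu c) xs (firstZero t x)
  eval-mu {x} tx = ev-mu (search-from (firstZero-zero t ≤-refl tx) (λ k → firstZero-minimal t x)
                                      (firstZero t x) (+-identityʳ _))

  mu-halts⇒zero : ∀ {y} → Eval g (mu c) xs y → t y ≡ 0
  mu-halts⇒zero (ev-mu s) = eval-deterministic (c-eval _) (search-end s)

π₀ : ∀ {n} → Code (suc n)
π₀ = proj fzero

π₁ : ∀ {n} → Code (suc (suc n))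
π₁ = proj (fsuc fzero)

π₂ : ∀ {n} → Code (suc (suc (suc n)))
π₂ = proj (fsuc (fsuc fzero))

infixr 9 _·_

_·_ : ∀ {n} → Code 1 → Code n → Code n
c · a = comp c (a ∷ [])

_⟨_,_⟩ : ∀ {n} → Code 2 → Code n → Code n → Code n
c ⟨ a , b ⟩ = comp c (a ∷ b ∷ [])

one : ∀ {n} → Code n
one = succ · zer

Computes₁ : Code 1 → (ℕ → ℕ) → Set
Computes₁ c h = ∀ {g} x → Eval g c (x ∷ []) (h x)

Computes₂ : Code 2 → (ℕ → ℕ → ℕ) → Set
Computes₂ c h = ∀ {g} x y → Eval g c (x ∷ y ∷ []) (h x y)

module _ {g : ℕ → ℕ} {n} {xs : Vec ℕ n} where
  ev-app₁ : ∀ {c : Code 1} {a : Code n} {x y} → Eval g c (x ∷ []) y → Eval g a xs x → Eval g (c · a) xs y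
  ev-app₁ ec ea = ev-comp (ea ∷ []) ec

  ev-app₂ : ∀ {c : Code 2} {a b : Code n} {x x′ y} →
            Eval g c (x ∷ x′ ∷ []) y → Eval g a xs x → Eval g b xs x′ → Eval g (c ⟨ a , b ⟩) xs y
  ev-app₂ ec ea eb = ev-comp (ea ∷ eb ∷ []) ec

  ev-one : Eval g one xs 1
  ev-one = ev-app₁ ev-succ ev-zer

predC : Code 1
predC = prec zer π₀

predC-computes : Computes₁ predC pred
predC-computes zero = ev-prec0 ev-zer
predC-computes (suc k) = ev-precS (predC-computes k) ev-proj

addC : Code 2
addC = prec π₀ (succ · π₁)

addC-computes : Computes₂ addC _+_
addC-computes zero b = ev-prec0 ev-proj
addC-computes (suc a) b = ev-precS (addC-computes a b) (ev-app₁ ev-succ ev-proj)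

monusC : Code 2
monusC = prec π₀ (predC · π₁) ⟨ π₁ , π₀ ⟩

monusC-computes : Computes₂ monusC _∸_
monusC-computes a b = ev-app₂ (flipped b a) ev-proj ev-proj
  where
  flipped : ∀ {g} k a → Eval g (prec π₀ (predC · π₁)) (k ∷ a ∷ []) (a ∸ k)
  flipped zero a = ev-prec0 ev-proj
  flipped (suc k) a = subst (Eval _ _ _) (pred[m∸n]≡m∸[1+n] a k)
                            (ev-precS (flipped k a) (ev-app₁ (predC-computes _) ev-proj))

mulC : Code 2
mulC = prec zer (addC ⟨ π₁ , π₂ ⟩)

mulC-computes : Computes₂ mulC _*_
mulC-computes zero b = ev-prec0 ev-zer
mulC-computes (suc a) b = subst (Eval _ _ _) (+-comm (a * b) b)
                                (ev-precS (mulC-computes a b) (ev-app₂ (addC-computes _ _) ev-proj ev-proj))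

∸+∸≡∣-∣ : ∀ a b → (a ∸ b) + (b ∸ a) ≡ ∣ a - b ∣
∸+∸≡∣-∣ zero b = cong (_+ (b ∸ 0)) (0∸n≡0 b)
∸+∸≡∣-∣ (suc a) zero = +-identityʳ (suc a)
∸+∸≡∣-∣ (suc a) (suc b) = ∸+∸≡∣-∣ a b

distC : Code 2
distC = addC ⟨ monusC ⟨ π₀ , π₁ ⟩ , monusC ⟨ π₁ , π₀ ⟩ ⟩

distC-computes : Computes₂ distC ∣_-_∣
distC-computes a b = subst (Eval _ _ _) (∸+∸≡∣-∣ a b)
  (ev-app₂ (addC-computes _ _) (ev-app₂ (monusC-computes a b) ev-proj ev-proj)
                               (ev-app₂ (monusC-computes b a) ev-proj ev-proj))

triC : Code 1
triC = prec zer (succ · addC ⟨ π₀ , π₁ ⟩)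

triC-computes : Computes₁ triC tri
triC-computes zero = ev-prec0 ev-zer
triC-computes (suc k) = ev-precS (triC-computes k) (ev-app₁ ev-succ (ev-app₂ (addC-computes _ _) ev-proj ev-proj))

pairC : Code 2
pairC = addC ⟨ triC · addC ⟨ π₀ , π₁ ⟩ , π₁ ⟩

pairC-computes : Computes₂ pairC ⟪_,_⟫
pairC-computes a b =
  ev-app₂ (addC-computes _ _) (ev-app₁ (triC-computes _) (ev-app₂ (addC-computes a b) ev-proj ev-proj)) ev-proj

2^suc : ∀ a → 2 ^ suc a ≡ 2 ^ a + 2 ^ a
2^suc a = cong (2 ^ a +_) (+-identityʳ (2 ^ a))

pow2C : Code 1
pow2C = prec one (addC ⟨ π₁ , π₁ ⟩)

pow2C-computes : Computes₁ pow2C (2 ^_)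
pow2C-computes zero = ev-prec0 ev-one
pow2C-computes (suc k) = subst (Eval _ _ _) (sym (2^suc k))
                               (ev-precS (pow2C-computes k) (ev-app₂ (addC-computes _ _) ev-proj ev-proj))

fromBool : Bool → ℕ
fromBool true = 1
fromBool false = 0

odd-suc : ∀ k → odd (suc k) ≡ not (odd k)
odd-suc zero = refl
odd-suc (suc zero) = refl
odd-suc (suc (suc k)) = odd-suc k

fromBool-not : ∀ b → fromBool (not b) ≡ 1 ∸ fromBool b
fromBool-not true = refl
fromBool-not false = refl

⌊suc/2⌋ : ∀ k → ⌊ suc k /2⌋ ≡ ⌊ k /2⌋ + fromBool (odd k)
⌊suc/2⌋ zero = refl
⌊suc/2⌋ (suc zero) = refl
⌊suc/2⌋ (suc (suc k)) = cong suc (⌊suc/2⌋ k)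

halvings : ℕ → ℕ → ℕ
halvings zero u = u
halvings (suc i) u = ⌊ halvings i u /2⌋

testBit≡odd-halvings : ∀ u i → testBit u i ≡ odd (halvings i u)
testBit≡odd-halvings u zero = refl
testBit≡odd-halvings u (suc i) = trans (testBit≡odd-halvings ⌊ u /2⌋ i) (cong odd (halvings-⌊/2⌋ i))
  where
  halvings-⌊/2⌋ : ∀ i → halvings i ⌊ u /2⌋ ≡ ⌊ halvings i u /2⌋
  halvings-⌊/2⌋ zero = refl
  halvings-⌊/2⌋ (suc i) = cong ⌊_/2⌋ (halvings-⌊/2⌋ i)

oddC : Code 1
oddC = prec zer (monusC ⟨ one , π₁ ⟩)

oddC-computes : Computes₁ oddC (λ k → fromBool (odd k))
oddC-computes zero = ev-prec0 ev-zer
oddC-computes (suc k) = subst (Eval _ _ _) (sym (trans (cong fromBool (odd-suc k)) (fromBool-not (odd k))))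
                              (ev-precS (oddC-computes k) (ev-app₂ (monusC-computes _ _) ev-one ev-proj))

halfC : Code 1
halfC = prec zer (addC ⟨ π₁ , oddC · π₀ ⟩)

halfC-computes : Computes₁ halfC ⌊_/2⌋
halfC-computes zero = ev-prec0 ev-zer
halfC-computes (suc k) = subst (Eval _ _ _) (sym (⌊suc/2⌋ k))
  (ev-precS (halfC-computes k) (ev-app₂ (addC-computes _ _) ev-proj (ev-app₁ (oddC-computes k) ev-proj)))

halvingsC : Code 2
halvingsC = prec π₀ (halfC · π₁)

halvingsC-computes : Computes₂ halvingsC halvings
halvingsC-computes zero u = ev-prec0 ev-proj
halvingsC-computes (suc i) u = ev-precS (halvingsC-computes i u) (ev-app₁ (halfC-computes _) ev-proj)

bitC : Code 2
bitC = oddC · halvingsC ⟨ π₁ , π₀ ⟩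

bitC-computes : Computes₂ bitC (λ u i → fromBool (testBit u i))
bitC-computes u i = subst (Eval _ _ _) (cong fromBool (sym (testBit≡odd-halvings u i)))
                          (ev-app₁ (oddC-computes _) (ev-app₂ (halvingsC-computes i u) ev-proj ev-proj))

-- Programs test a condition by computing a number that is 0 exactly when it holds.
notBit : ℕ → ℕ → ℕ
notBit u i = 1 ∸ fromBool (testBit u i)

notBitC : Code 2
notBitC = monusC ⟨ one , bitC ⟩

notBitC-computes : Computes₂ notBitC notBit
notBitC-computes u i = ev-app₂ (monusC-computes _ _) ev-one (bitC-computes u i)

notBit≡0⇒∈D : ∀ u i → notBit u i ≡ 0 → i ∈D u
notBit≡0⇒∈D u i eq with testBit u i
... | true = refl
notBit≡0⇒∈D u i () | false

∈D⇒notBit≡0 : ∀ u i → i ∈D u → notBit u i ≡ 0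
∈D⇒notBit≡0 u i i∈u rewrite i∈u = refl

odd-double : ∀ c → odd (c + c) ≡ false
odd-double zero = refl
odd-double (suc c) rewrite +-suc c c = odd-double c

odd-+-even : ∀ u c → odd (u + (c + c)) ≡ odd u
odd-+-even zero c = odd-double c
odd-+-even (suc zero) c rewrite odd-suc (c + c) | odd-double c = refl
odd-+-even (suc (suc u)) c = odd-+-even u c

⌊+-even/2⌋ : ∀ u c → ⌊ u + (c + c) /2⌋ ≡ ⌊ u /2⌋ + c
⌊+-even/2⌋ zero c = sym (n≡⌊n+n/2⌋ c)
⌊+-even/2⌋ (suc zero) c rewrite ⌊suc/2⌋ (c + c) | odd-double c = trans (+-identityʳ _) (sym (n≡⌊n+n/2⌋ c))
⌊+-even/2⌋ (suc (suc u)) c = cong suc (⌊+-even/2⌋ u c)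

testBit-0 : ∀ p → testBit 0 p ≡ false
testBit-0 zero = refl
testBit-0 (suc p) = testBit-0 p

testBit-+2^-self : ∀ a u → testBit u a ≡ false → a ∈D (u + 2 ^ a)
testBit-+2^-self zero u a∉u rewrite +-comm u 1 | odd-suc u | a∉u = refl
testBit-+2^-self (suc a) u a∉u rewrite 2^suc a | ⌊+-even/2⌋ u (2 ^ a) = testBit-+2^-self a ⌊ u /2⌋ a∉u

testBit-+2^-other : ∀ a u p → testBit u a ≡ false → p ≢ a → testBit (u + 2 ^ a) p ≡ testBit u p
testBit-+2^-other zero u zero a∉u p≢a = ⊥-elim (p≢a refl)
testBit-+2^-other zero u (suc p) a∉u p≢a rewrite +-comm u 1 | ⌊suc/2⌋ u | a∉u | +-identityʳ ⌊ u /2⌋ = refl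
testBit-+2^-other (suc a) u zero a∉u p≢a rewrite 2^suc a = odd-+-even u (2 ^ a)
testBit-+2^-other (suc a) u (suc p) a∉u p≢a rewrite 2^suc a | ⌊+-even/2⌋ u (2 ^ a) =
  testBit-+2^-other a ⌊ u /2⌋ p a∉u (λ p≡a → p≢a (cong suc p≡a))

testBit-2^-self : ∀ a → a ∈D (2 ^ a)
testBit-2^-self a = testBit-+2^-self a 0 (testBit-0 a)

∈D-2^⇒≡ : ∀ a p → p ∈D (2 ^ a) → p ≡ a
∈D-2^⇒≡ a p p∈ with p ≟ a
... | yes p≡a = p≡a
... | no p≢a with trans (sym (testBit-0 p)) (trans (sym (testBit-+2^-other a 0 p (testBit-0 a) p≢a)) p∈)
...   | ()

⌊/2⌋+⌊/2⌋≤ : ∀ x → ⌊ x /2⌋ + ⌊ x /2⌋ ≤ x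
⌊/2⌋+⌊/2⌋≤ x = ≤-trans (+-monoʳ-≤ ⌊ x /2⌋ (⌊n/2⌋≤⌈n/2⌉ x)) (≤-reflexive (⌊n/2⌋+⌈n/2⌉≡n x))

∈D⇒< : ∀ p x → p ∈D x → p < x
∈D⇒< zero (suc x) _ = s≤s z≤n
∈D⇒< (suc p) x p∈ = ≤-trans (s≤s (m≤n+m (suc p) p))
                            (≤-trans (+-mono-≤ ih ih) (⌊/2⌋+⌊/2⌋≤ x))
  where
  ih : p < ⌊ x /2⌋
  ih = ∈D⇒< p ⌊ x /2⌋ p∈

tri-mono-≤ : ∀ {s s′} → s ≤ s′ → tri s ≤ tri s′
tri-mono-≤ {zero} _ = z≤n
tri-mono-≤ {suc s} (s≤s s≤s′) = +-mono-≤ (s≤s s≤s′) (tri-mono-≤ s≤s′)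

-- The pairs on the diagonal x + y = s occupy [tri s, tri s + s], below tri (suc s).
⟪⟫-<-diagonal : ∀ a b c d → a + b < c + d → ⟪ a , b ⟫ < ⟪ c , d ⟫
⟪⟫-<-diagonal a b c d lt = ≤-trans (≤-trans gap (tri-mono-≤ lt)) (m≤m+n _ d)
  where
  gap : ⟪ a , b ⟫ < tri (suc (a + b))
  gap = s≤s (≤-trans (+-monoʳ-≤ (tri (a + b)) (m≤n+m b a)) (≤-reflexive (+-comm (tri (a + b)) (a + b))))

⟪⟫-injective : ∀ {a b c d} → ⟪ a , b ⟫ ≡ ⟪ c , d ⟫ → a ≡ c × b ≡ d
⟪⟫-injective {a} {b} {c} {d} eq with <-cmp (a + b) (c + d)
... | tri< lt _ _ = ⊥-elim (<-irrefl eq (⟪⟫-<-diagonal a b c d lt))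
... | tri> _ _ gt = ⊥-elim (<-irrefl (sym eq) (⟪⟫-<-diagonal c d a b gt))
... | tri≈ _ s≡ _ = a≡c , b≡d
  where
  b≡d : b ≡ d
  b≡d = +-cancelˡ-≡ (tri (a + b)) b d (trans eq (cong (λ s → tri s + d) (sym s≡)))
  a≡c : a ≡ c
  a≡c = +-cancelʳ-≡ b a c (trans s≡ (cong (c +_) (sym b≡d)))

≤-⟪⟫ : ∀ a b → b ≤ ⟪ a , b ⟫
≤-⟪⟫ a b = m≤n+m b (tri (a + b))

valueAt-test : ℕ → ℕ → ℕ → ℕ
valueAt-test u i v = notBit u ⟪ i , v ⟫ * (u ∸ v)

-- The least v with ⟪ i , v ⟫ ∈D u, read off u as the graph of a finite function;
-- the factor u ∸ v stops the search at u, which is returned when there is no such v.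
valueAt : ℕ → ℕ → ℕ
valueAt u i = firstZero (valueAt-test u i) u

valueAt-testC : Code 3
valueAt-testC = mulC ⟨ notBitC ⟨ π₁ , pairC ⟨ π₂ , π₀ ⟩ ⟩ , monusC ⟨ π₁ , π₀ ⟩ ⟩

valueAtC : Code 2
valueAtC = mu valueAt-testC

valueAtC-computes : Computes₂ valueAtC valueAt
valueAtC-computes u i = eval-mu (valueAt-test u i) test-computes stops-at-u
  where
  test-computes : ∀ {g} v → Eval g valueAt-testC (v ∷ u ∷ i ∷ []) (valueAt-test u i v)
  test-computes v = ev-app₂ (mulC-computes _ _)
                      (ev-app₂ (notBitC-computes _ _) ev-proj (ev-app₂ (pairC-computes i v) ev-proj ev-proj))
                      (ev-app₂ (monusC-computes u v) ev-proj ev-proj)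
  stops-at-u : valueAt-test u i u ≡ 0
  stops-at-u = trans (cong (notBit u ⟪ i , u ⟫ *_) (n∸n≡0 u)) (*-zeroʳ (notBit u ⟪ i , u ⟫))

valueAt-unique : ∀ {u i v} → ⟪ i , v ⟫ ∈D u → (∀ v′ → ⟪ i , v′ ⟫ ∈D u → v′ ≡ v) → valueAt u i ≡ v
valueAt-unique {u} {i} {v} v∈ unique =
  firstZero-unique (valueAt-test u i) (<⇒≤ v<u) (cong (_* (u ∸ v)) (∈D⇒notBit≡0 u ⟪ i , v ⟫ v∈)) below
  where
  v<u : v < u
  v<u = ≤-<-trans (≤-⟪⟫ i v) (∈D⇒< _ u v∈)
  below : ∀ k → k < v → valueAt-test u i k ≢ 0
  below k k<v test≡0 with m*n≡0⇒m≡0∨n≡0 (notBit u ⟪ i , k ⟫) test≡0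
  ... | inj₁ notBit≡0 = <-irrefl (unique k (notBit≡0⇒∈D u ⟪ i , k ⟫ notBit≡0)) k<v
  ... | inj₂ u∸k≡0 = <-irrefl refl (<-≤-trans (<-trans k<v v<u) (m∸n≡0⇒m≤n u∸k≡0))

undefinedAt : ℕ → ℕ → ℕ
undefinedAt u i = notBit u ⟪ i , valueAt u i ⟫

undefinedAtC : Code 2
undefinedAtC = notBitC ⟨ π₀ , pairC ⟨ π₁ , valueAtC ⟩ ⟩

undefinedAtC-computes : Computes₂ undefinedAtC undefinedAt
undefinedAtC-computes u i =
  ev-app₂ (notBitC-computes _ _) ev-proj (ev-app₂ (pairC-computes _ _) ev-proj (valueAtC-computes u i))

undefinedAt-unique : ∀ {u i v} → ⟪ i , v ⟫ ∈D u → (∀ v′ → ⟪ i , v′ ⟫ ∈D u → v′ ≡ v) →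
                     undefinedAt u i ≡ 0
undefinedAt-unique {u} {i} v∈ unique =
  ∈D⇒notBit≡0 u ⟪ i , valueAt u i ⟫
    (subst (λ v → ⟪ i , v ⟫ ∈D u) (sym (valueAt-unique {u} {i} v∈ unique)) v∈)

segment : (ℕ → ℕ) → ℕ → ℕ
segment v zero = zero
segment v (suc n) = segment v n + 2 ^ ⟪ n , v n ⟫

mutual
  ∈-segment⇒ : ∀ v n {p} → p ∈D segment v n → ∃ λ j → j < n × p ≡ ⟪ j , v j ⟫
  ∈-segment⇒ v zero {p} p∈ with trans (sym (testBit-0 p)) p∈
  ... | ()
  ∈-segment⇒ v (suc n) {p} p∈ with p ≟ ⟪ n , v n ⟫
  ... | yes p≡ = n , ≤-refl , p≡
  ... | no p≢ with ∈-segment⇒ v n (trans (sym (testBit-+2^-other ⟪ n , v n ⟫ _ p (segment-fresh v n) p≢)) p∈)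
  ...   | j , j<n , p≡ = j , m≤n⇒m≤1+n j<n , p≡

  segment-fresh : ∀ v n → testBit (segment v n) ⟪ n , v n ⟫ ≡ false
  segment-fresh v n with testBit (segment v n) ⟪ n , v n ⟫ in eq
  ... | false = refl
  ... | true with ∈-segment⇒ v n eq
  ...   | j , j<n , p≡ = ⊥-elim (<-irrefl (sym (proj₁ (⟪⟫-injective p≡))) j<n)

∈-segment : ∀ v n {j} → j < n → ⟪ j , v j ⟫ ∈D segment v n
∈-segment v (suc n) {j} j<1+n with j ≟ n
... | yes refl = testBit-+2^-self ⟪ j , v j ⟫ (segment v j) (segment-fresh v j)
... | no j≢n =
  trans (testBit-+2^-other ⟪ n , v n ⟫ _ _ (segment-fresh v n) (λ eq → j≢n (proj₁ (⟪⟫-injective eq))))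
        (∈-segment v n (≤∧≢⇒< (s≤s⁻¹ j<1+n) j≢n))

segment-cong : ∀ {v w} n → (∀ j → j < n → v j ≡ w j) → segment v n ≡ segment w n
segment-cong zero agree = refl
segment-cong (suc n) agree = cong₂ (λ s x → s + 2 ^ ⟪ n , x ⟫)
                                   (segment-cong n (λ j j<n → agree j (m≤n⇒m≤1+n j<n))) (agree n ≤-refl)

segment-<-suc : ∀ v n → segment v n < segment v (suc n)
segment-<-suc v n = m<m+n (segment v n) (m^n>0 2 ⟪ n , v n ⟫)

segmentC : Code 2 → Code 2
segmentC v = prec zer (addC ⟨ π₁ , pow2C · pairC ⟨ π₀ , v ⟨ π₀ , π₂ ⟩ ⟩ ⟩)

segmentC-computes : ∀ {g} {v : Code 2} {h : ℕ → ℕ} {x} → (∀ k → Eval g v (k ∷ x ∷ []) (h k)) →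
                    ∀ n → Eval g (segmentC v) (n ∷ x ∷ []) (segment h n)
segmentC-computes v-computes zero = ev-prec0 ev-zer
segmentC-computes v-computes (suc n) =
  ev-precS (segmentC-computes v-computes n)
           (ev-app₂ (addC-computes _ _) ev-proj
                    (ev-app₁ (pow2C-computes _)
                             (ev-app₂ (pairC-computes _ _) ev-proj (ev-app₂ (v-computes n) ev-proj ev-proj))))

infix 4 _⊆ᴰ_

_⊆ᴰ_ : ℕ → SetN → Set
u ⊆ᴰ C = ∀ i → i ∈D u → C i

≤e-by-search : ∀ {A C : SetN} (T : Code 3) (t : ℕ → ℕ → ℕ → ℕ) →
               (∀ {g} x u n → Eval g T (n ∷ x ∷ u ∷ []) (t x u n)) →
               (∀ x → A x → ∃ λ u → (∃ λ n → t x u n ≡ 0) × u ⊆ᴰ C) →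
               (∀ x u n → t x u n ≡ 0 → u ⊆ᴰ C → A x) →
               A ≤e C
≤e-by-search {A} {C} T t T-computes complete sound = Axiom , (mu T , λ x u → id , id) , λ x → enumerate x , decode x
  where
  Axiom : ℕ → ℕ → Set
  Axiom x u = Σ ℕ (Eval (λ _ → 0) (mu T) (x ∷ u ∷ []))
  enumerate : ∀ x → A x → ∃ λ u → Axiom x u × u ⊆ᴰ C
  enumerate x x∈A with complete x x∈A
  ... | u , (n , t≡0) , u⊆C = u , (_ , eval-mu (t x u) (T-computes x u) t≡0) , u⊆C
  decode : ∀ x → (∃ λ u → Axiom x u × u ⊆ᴰ C) → A x
  decode x (u , (n , halts) , u⊆C) = sound x u n (mu-halts⇒zero (t x u) (T-computes x u) halts) u⊆C

injective⇒unbounded : ∀ {h : ℕ → ℕ} → Injective _≡_ _≡_ h → ∀ c → ∃ λ m → c < h m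
injective⇒unbounded {h} h-injective c with Fin.any? (λ (i : Fin (2 + c)) → c <? h (toℕ i))
... | yes (i , c<h) = toℕ i , c<h
-- Otherwise h maps 0, …, c + 1 into 0, …, c, so two of them collide.
... | no none with Fin.pigeonhole (n<1+n (suc c)) (λ i → fromℕ< (s≤s (≮⇒≥ (λ c<h → none (i , c<h)))))
...   | i , j , i<j , same =
  ⊥-elim (<-irrefl (h-injective (trans (sym (Fin.toℕ-fromℕ< _)) (trans (cong toℕ same) (Fin.toℕ-fromℕ< _)))) i<j)

increasing⇒strictlyMonotone : ∀ {h : ℕ → ℕ} → (∀ n → h n < h (suc n)) → ∀ {m n} → m < n → h m < h n
increasing⇒strictlyMonotone increasing {m} {suc n} m<1+n with m<1+n⇒m<n∨m≡n m<1+n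
... | inj₁ m<n = <-trans (increasing⇒strictlyMonotone increasing m<n) (increasing n)
... | inj₂ refl = increasing n

increasing⇒injective : ∀ {h : ℕ → ℕ} → (∀ n → h n < h (suc n)) → Injective _≡_ _≡_ h
increasing⇒injective increasing {m} {n} hm≡hn with <-cmp m n
... | tri< m<n _ _ = ⊥-elim (<-irrefl hm≡hn (increasing⇒strictlyMonotone increasing m<n))
... | tri≈ _ m≡n _ = m≡n
... | tri> _ _ n<m = ⊥-elim (<-irrefl (sym hm≡hn) (increasing⇒strictlyMonotone increasing n<m))

module _ (f : ℕ → ℕ) where

  graph-functional : ∀ {i v} → graph f ⟪ i , v ⟫ → v ≡ f i
  graph-functional {i} {v} (n , eq) with ⟪⟫-injective {i} {v} {n} {f n} eq
  ... | refl , v≡ = v≡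

  ⊆graph⇒valueAt : ∀ {u i} → u ⊆ᴰ graph f → ⟪ i , f i ⟫ ∈D u → valueAt u i ≡ f i
  ⊆graph⇒valueAt {u} {i} u⊆ fi∈ = valueAt-unique {u} {i} fi∈ (λ v′ v′∈ → graph-functional (u⊆ _ v′∈))

  ⊆graph⇒undefinedAt≡0 : ∀ {u i} → u ⊆ᴰ graph f → ⟪ i , f i ⟫ ∈D u → undefinedAt u i ≡ 0
  ⊆graph⇒undefinedAt≡0 {u} {i} u⊆ fi∈ =
    undefinedAt-unique {u} {i} fi∈ (λ v′ v′∈ → graph-functional (u⊆ _ v′∈))

  segment⊆graph : ∀ n → segment f n ⊆ᴰ graph f
  segment⊆graph n p p∈ with ∈-segment⇒ f n p∈
  ... | j , _ , p≡ = j , p≡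

  SegmentCodes : SetN
  SegmentCodes u = ∃ λ n → u ≡ segment f n

-- If every φ (g m) codes a finite part of graph f and these parts cover the graph, then g
-- computes f: to find f i, search for a stage m at which φ (g m) contains a pair ⟪ i , _ ⟫.
module ValueSearch (F : Code 1) (φ : ℕ → ℕ) (F-computes : Computes₁ F φ) where

  stageTestC : Code 2
  stageTestC = undefinedAtC ⟨ F · orc · π₀ , π₁ ⟩

  valueC : Code 1
  valueC = valueAtC ⟨ F · orc · mu stageTestC , π₀ ⟩

  valueC-computes : ∀ f g → (∀ m → φ (g m) ⊆ᴰ graph f) → (∀ i → ∃ λ m → ⟪ i , f i ⟫ ∈D φ (g m)) →
                    ∀ i → Eval g valueC (i ∷ []) (f i)
  valueC-computes f g sound complete i =
    subst (Eval g valueC (i ∷ [])) value≡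
          (ev-app₂ (valueAtC-computes _ _) (ev-app₁ (F-computes _) (ev-app₁ ev-orc stage-eval)) ev-proj)
    where
    t : ℕ → ℕ
    t m = undefinedAt (φ (g m)) i
    t-computes : ∀ m → Eval g stageTestC (m ∷ i ∷ []) (t m)
    t-computes m = ev-app₂ (undefinedAtC-computes _ _) (ev-app₁ (F-computes _) (ev-app₁ ev-orc ev-proj)) ev-proj
    m₀ : ℕ
    m₀ = proj₁ (complete i)
    stage : ℕ
    stage = firstZero t m₀
    stage-eval : Eval g (mu stageTestC) (i ∷ []) stage
    stage-eval = eval-mu t t-computes (⊆graph⇒undefinedAt≡0 f {i = i} (sound m₀) (proj₂ (complete i)))
    value≡ : valueAt (φ (g stage)) i ≡ f i
    value≡ = graph-functional f (sound stage _ (notBit≡0⇒∈D (φ (g stage)) ⟪ i , valueAt (φ (g stage)) i ⟫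
                                                  (mu-halts⇒zero t t-computes stage-eval)))

module _ (f : ℕ → ℕ) where

  segments≤e-graph : SegmentCodes f ≤e graph f
  segments≤e-graph = ≤e-by-search T t T-computes complete sound
    where
    T : Code 3
    T = addC ⟨ distC ⟨ π₁ , π₂ ⟩ , distC ⟨ π₂ , segmentC (valueAtC ⟨ π₁ , π₀ ⟩) ⟨ π₀ , π₂ ⟩ ⟩ ⟩
    t : ℕ → ℕ → ℕ → ℕ
    t x u n = ∣ x - u ∣ + ∣ u - segment (valueAt u) n ∣
    T-computes : ∀ {g} x u n → Eval g T (n ∷ x ∷ u ∷ []) (t x u n)
    T-computes x u n =
      ev-app₂ (addC-computes _ _) (ev-app₂ (distC-computes x u) ev-proj ev-proj)
              (ev-app₂ (distC-computes _ _) ev-proj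
                       (ev-app₂ (segmentC-computes (λ k → ev-app₂ (valueAtC-computes u k) ev-proj ev-proj) n)
                                ev-proj ev-proj))
    complete : ∀ x → SegmentCodes f x → ∃ λ u → (∃ λ n → t x u n ≡ 0) × u ⊆ᴰ graph f
    complete x (n , refl) =
      segment f n , (n , cong₂ _+_ (∣n-n∣≡0 (segment f n)) (m≡n⇒∣m-n∣≡0 (sym decoded))) , segment⊆graph f n
      where
      decoded : segment (valueAt (segment f n)) n ≡ segment f n
      decoded = segment-cong n (λ j j<n → ⊆graph⇒valueAt f (segment⊆graph f n) (∈-segment f n j<n))
    sound : ∀ x u n → t x u n ≡ 0 → u ⊆ᴰ graph f → SegmentCodes f x
    sound x u n t≡0 u⊆graph = n , trans x≡u (trans u≡ (segment-cong n agree))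
      where
      x≡u : x ≡ u
      x≡u = ∣m-n∣≡0⇒m≡n (m+n≡0⇒m≡0 _ t≡0)
      u≡ : u ≡ segment (valueAt u) n
      u≡ = ∣m-n∣≡0⇒m≡n (m+n≡0⇒n≡0 ∣ x - u ∣ t≡0)
      agree : ∀ j → j < n → valueAt u j ≡ f j
      agree j j<n =
        graph-functional f (u⊆graph _ (subst (⟪ j , valueAt u j ⟫ ∈D_) (sym u≡) (∈-segment (valueAt u) n j<n)))

  graph≤e-segments : graph f ≤e SegmentCodes f
  graph≤e-segments = ≤e-by-search T t T-computes complete sound
    where
    T : Code 3
    T = addC ⟨ distC ⟨ π₂ , pow2C · π₀ ⟩ , notBitC ⟨ π₀ , π₁ ⟩ ⟩
    t : ℕ → ℕ → ℕ → ℕ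
    t p u z = ∣ u - 2 ^ z ∣ + notBit z p
    T-computes : ∀ {g} p u z → Eval g T (z ∷ p ∷ u ∷ []) (t p u z)
    T-computes p u z =
      ev-app₂ (addC-computes _ _) (ev-app₂ (distC-computes _ _) ev-proj (ev-app₁ (pow2C-computes z) ev-proj))
              (ev-app₂ (notBitC-computes z p) ev-proj ev-proj)
    complete : ∀ p → graph f p → ∃ λ u → (∃ λ z → t p u z ≡ 0) × u ⊆ᴰ SegmentCodes f
    complete p (n , refl) =
      2 ^ z , (z , cong₂ _+_ (∣n-n∣≡0 (2 ^ z)) (∈D⇒notBit≡0 z p (∈-segment f (suc n) ≤-refl))) ,
      λ i i∈ → suc n , ∈D-2^⇒≡ z i i∈
      where
      z = segment f (suc n)
    sound : ∀ p u z → t p u z ≡ 0 → u ⊆ᴰ SegmentCodes f → graph f p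
    sound p u z t≡0 u⊆segments with u⊆segments z (subst (z ∈D_) (sym u≡) (testBit-2^-self z))
      where
      u≡ : u ≡ 2 ^ z
      u≡ = ∣m-n∣≡0⇒m≡n (m+n≡0⇒m≡0 _ t≡0)
    ... | m , refl = segment⊆graph f m p (notBit≡0⇒∈D z p (m+n≡0⇒n≡0 ∣ u - 2 ^ z ∣ t≡0))

  ℰ-graph≤s-𝒞-segments : ℰ (graph f) ≤s 𝒞 (SegmentCodes f)
  ℰ-graph≤s-𝒞-segments = pairC ⟨ π₀ , valueC ⟩ , reduce
    where
    open ValueSearch π₀ id (λ x → ev-proj)
    reduce : ∀ g → 𝒞 (SegmentCodes f) g →
             Σ (ℕ → ℕ) λ h → (∀ n → Eval g (pairC ⟨ π₀ , valueC ⟩) (n ∷ []) (h n)) × ℰ (graph f) h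
    reduce g (g-injective , g∈) =
      (λ n → ⟪ n , f n ⟫) ,
      (λ n → ev-app₂ (pairC-computes n (f n)) ev-proj (valueC-computes f g sound complete n)) ,
      (λ n → n , refl) , λ { a (n , a≡) → n , sym a≡ }
      where
      len : ℕ → ℕ
      len m = proj₁ (g∈ m)
      g≡ : ∀ m → g m ≡ segment f (len m)
      g≡ m = proj₂ (g∈ m)
      sound : ∀ m → g m ⊆ᴰ graph f
      sound m rewrite g≡ m = segment⊆graph f (len m)
      len-injective : Injective _≡_ _≡_ len
      len-injective eq = g-injective (trans (g≡ _) (trans (cong (segment f) eq) (sym (g≡ _))))
      complete : ∀ i → ∃ λ m → ⟪ i , f i ⟫ ∈D g m
      complete i with injective⇒unbounded len-injective i
      ... | m , i<len = m , subst (⟪ i , f i ⟫ ∈D_) (sym (g≡ m)) (∈-segment f (len m) i<len)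

  𝒞-segments≤s-ℰ-graph : 𝒞 (SegmentCodes f) ≤s ℰ (graph f)
  𝒞-segments≤s-ℰ-graph = segmentC (valueC · π₀) ⟨ π₀ , π₀ ⟩ , reduce
    where
    open ValueSearch pow2C (2 ^_) pow2C-computes
    reduce : ∀ g → ℰ (graph f) g →
             Σ (ℕ → ℕ) λ h → (∀ n → Eval g (segmentC (valueC · π₀) ⟨ π₀ , π₀ ⟩) (n ∷ []) (h n)) ×
                             𝒞 (SegmentCodes f) h
    reduce g (g∈ , g-onto) =
      segment f ,
      (λ n → ev-app₂ (segmentC-computes (λ k → ev-app₁ (valueC-computes f g sound complete k) ev-proj) n)
                     ev-proj ev-proj) ,
      increasing⇒injective (segment-<-suc f) , (λ n → n , refl)
      where
      sound : ∀ m → 2 ^ g m ⊆ᴰ graph f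
      sound m p p∈ = subst (graph f) (sym (∈D-2^⇒≡ (g m) p p∈)) (g∈ m)
      complete : ∀ i → ∃ λ m → ⟪ i , f i ⟫ ∈D (2 ^ g m)
      complete i with g-onto ⟪ i , f i ⟫ (i , refl)
      ... | m , g≡ = m , subst (λ a → ⟪ i , f i ⟫ ∈D (2 ^ a)) (sym g≡) (testBit-2^-self ⟪ i , f i ⟫)

proposition8 : (f : ℕ → ℕ) →
    Σ SetN (λ B → (B ≡e graph f) × (𝒞 B ≡s ℰ (graph f)))
proposition8 f =
  SegmentCodes f ,
  (segments≤e-graph f , graph≤e-segments f) ,
  (𝒞-segments≤s-ℰ-graph f , ℰ-graph≤s-𝒞-segments f)
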